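{- If $N$ is a product of two distinct primes, then $\varphi(N) = \lambda(N)\cdot \gcd(N-1, \lambda(N))$.
   Context: $\varphi$ denotes Euler's totient function and $\lambda$ denotes Carmichael's function, i.e. $\lambda(N)$ is the exponent of the group $(\mathbb{Z}/N\mathbb{Z})^\times$; for $N = p_1p_2$ with distinct odd primes, $\lambda(N) = \mathrm{lcm}(p_1-1,p_2-1)$. -}

module Defs where

open import Data.Nat using (ℕ; zero; suc; _*_; _^_; _<_; _≤_; NonZero)
open import Data.Nat.DivMod using (_%_)
open import Data.Nat.Coprimality using (Coprime; coprime?)
open import Data.List using (List; length; filter; upTo)
open import Data.Product using (_×_)
open import Relation.Binary.PropositionalEquality using (_≡_)

-- Euler's totient: number of k ∈ {0,…,N-1} with gcd(k,N) = 1
-- (gives φ(1) = 1, and φ(N) = #{1 ≤ k ≤ N : gcd(k,N)=1} for N ≥ 1).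
φ : ℕ → ℕ
φ N = length (filter (λ k → coprime? k N) (upTo N))

Annihilates : (N m : ℕ) → .{{_ : NonZero N}} → Set
Annihilates N m = ∀ a → Coprime a N → (a ^ m) % N ≡ 1 % N

IsCarmichael : (N L : ℕ) → .{{_ : NonZero N}} → Set
IsCarmichael N L =
  (1 ≤ L) × Annihilates N L × (∀ m → 1 ≤ m → Annihilates N m → L ≤ m)

{-# OPTIONS --safe #-}
module Submission where

-- φ(pq) = (p − 1)(q − 1) by inclusion–exclusion over the multiples of p and of q below pq.
-- The exponent of (ℤ/pqℤ)^× is lcm(p − 1, q − 1): this annihilates every unit by Fermat's
-- little theorem modulo p and modulo q, and conversely a unit modulo p lifts to a unit
-- modulo pq, so an exponent L of (ℤ/pqℤ)^× kills every unit modulo p, which forces p − 1 ∣ L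
-- because otherwise x^(L mod (p − 1)) − 1 would have more roots modulo p than its degree.
-- Finally, for a, b with g = gcd(a, b), a = g a′, b = g b′ one has ab + a + b = g (a′b′g + a′ + b′)
-- and lcm(a, b) = g a′b′ with a′b′ coprime to a′b′g + a′ + b′, so
-- lcm(a, b) · gcd(ab + a + b, lcm(a, b)) = lcm(a, b) · g = ab; take a = p − 1, b = q − 1.

open import Algebra.Bundles using (CommutativeSemiring; Monoid)
import Algebra.Definitions.RawMonoid as RawMonoid
import Algebra.Properties.CommutativeSemiring.Binomial as Binomial
import Algebra.Properties.Monoid.Sum as MonoidSum
import Algebra.Properties.Semiring.Exp as SemiringExp
open import Data.Bool.Base using (true; false; if_then_else_)
open import Data.Empty using (⊥-elim)
open import Data.Fin.Base using (zero; suc; inject₁; fromℕ; toℕ)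
open import Data.Fin.Properties using (inject₁ℕ<; toℕ-fromℕ)
open import Data.Integer.Base as ℤ using (ℤ; +_; 0ℤ; 1ℤ)
open import Data.Integer.Divisibility.Signed
  using (∣m∣n⇒∣m+n; ∣m⇒∣-m; ∣m⇒∣m*n; ∣n⇒∣m*n; ∣⇒∣ᵤ; ∣ᵤ⇒∣) renaming (_∣_ to _∣ℤ_; divides to dividesℤ)
import Data.Integer.Properties as ℤ
import Data.Integer.Tactic.RingSolver as ℤ-Solver
open import Data.List.Base
  using (List; []; _∷_; [_]; _++_; _∷ʳ_; length; replicate; applyUpTo; filter; upTo)
open import Data.List.Properties using (length-applyUpTo; length-replicate; length-++; filter-++; upTo-∷ʳ)
open import Data.List.Relation.Unary.All using (All; []; _∷_)
import Data.List.Relation.Unary.All.Properties as All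
open import Data.List.Relation.Unary.AllPairs using (AllPairs; []; _∷_)
import Data.List.Relation.Unary.AllPairs.Properties as AllPairs
open import Data.Nat.Base
  using (ℕ; zero; suc; _!; _+_; _*_; _^_; _∸_; _<_; _≤_; z≤n; s≤s; z<s; NonZero;
         nonTrivial⇒n>1; >-nonZero; >-nonZero⁻¹; ≢-nonZero; ≢-nonZero⁻¹)
open import Data.Nat.Combinatorics using (_C_; nCn≡1; nCk≡n!/k![n-k]!; k![n∸k]!∣n!)
open import Data.Nat.Coprimality as Coprime
  using (Coprime; coprime?; coprime-divisor; coprime-+; coprime-/gcd; coprime⇒gcd≡1)
open import Data.Nat.DivMod using (_%_; _/_; m≡m%n+[m/n]*n; %-remove-+ʳ; m/n*n≡m; m%n<n; m<n⇒m%n≡m)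
open import Data.Nat.Divisibility as ℕ using (_∣_; _∣?_; divides; >⇒∤; m%n≡0⇒n∣m; ∣m+n∣m⇒∣n)
open import Data.Nat.GCD using (gcd; gcd[m,n]∣m; gcd[m,n]∣n; gcd[m,n]≢0; c*gcd[m,n]≡gcd[cm,cn])
open import Data.Nat.LCM using (lcm; gcd*lcm; lcm-least; m∣lcm[m,n]; n∣lcm[m,n])
open import Data.Nat.Primality
  using (Prime; prime⇒nonZero; prime⇒nonTrivial; prime⇒irreducible; ¬prime[0]; ¬prime[1]; euclidsLemma)
open import Data.Nat.Properties
  using (+-comm; +-assoc; +-identityʳ; *-comm; *-identityˡ; *-identityʳ; +-cancelʳ-≡; *-cancelˡ-≡;
         m*n≢0; m*n≢0⇒n≢0; _!*_!≢0; ≤-refl; ≤-total; ≤-antisym; <-trans; ≤-<-trans; n<1+n; <⇒≤; <⇒≢; <⇒≱;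
         suc-injective; m+[n∸m]≡n; n∸n≡0; ∸-monoʳ-<)
import Data.Nat.Tactic.RingSolver as ℕ-Solver
open import Data.Product using (_,_; _×_; ∃-syntax)
open import Data.Sum using (_⊎_; inj₁; inj₂; [_,_]′)
open import Data.Vec.Functional using (Vector; init; last; tail)
open import Function using (_∘_)
open import Level using (0ℓ)
open import Relation.Binary.Bundles using (Setoid)
open import Relation.Binary.PropositionalEquality
  using (_≡_; _≢_; refl; sym; trans; cong; cong₂; subst; subst₂; module ≡-Reasoning)
import Relation.Binary.Reasoning.Setoid as SetoidReasoning
open import Relation.Nullary using (¬_; Dec; does; yes; no)
open import Relation.Nullary.Decidable using (dec-true; dec-false)
open import Relation.Unary using (Pred; Decidable)

open import Defs

-- Primes and coprimality

prime>1 : ∀ {p} → Prime p → 1 < p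
prime>1 {p} p-prime = nonTrivial⇒n>1 p {{prime⇒nonTrivial p-prime}}

prime∤⇒coprime : ∀ {p k} → Prime p → ¬ p ∣ k → Coprime k p
prime∤⇒coprime p-prime p∤k (d∣k , d∣p) with prime⇒irreducible p-prime d∣p
... | inj₁ d≡1 = d≡1
... | inj₂ refl = ⊥-elim (p∤k d∣k)

prime∤prime : ∀ {p q} → Prime p → Prime q → p ≢ q → ¬ p ∣ q
prime∤prime p-prime q-prime p≢q p∣q with prime⇒irreducible q-prime p∣q
... | inj₁ refl = <⇒≢ (prime>1 p-prime) refl
... | inj₂ p≡q = p≢q p≡q

coprime-*ʳ : ∀ {k m n} → Coprime k m → Coprime k n → Coprime k (m * n)
coprime-*ʳ k⊥m k⊥n (d∣k , d∣m*n) = k⊥n (d∣k , coprime-divisor d⊥m d∣m*n)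
  where d⊥m : Coprime _ _
        d⊥m (e∣d , e∣m) = k⊥m (ℕ.∣-trans e∣d d∣k , e∣m)

coprime⇒∤ : ∀ {k n d} → Coprime k n → d ∣ n → 1 < d → ¬ d ∣ k
coprime⇒∤ k⊥n d∣n 1<d d∣k = <⇒≢ 1<d (sym (k⊥n (d∣k , d∣n)))

coprime-∣⇒*∣ : ∀ {m n k} → Coprime m n → m ∣ k → n ∣ k → m * n ∣ k
coprime-∣⇒*∣ {m} {n} m⊥n (divides a refl) n∣a*m = subst (m * n ∣_) (*-comm m a)
  (ℕ.*-monoʳ-∣ m (coprime-divisor (Coprime.sym m⊥n) (subst (n ∣_) (*-comm a m) n∣a*m)))

∤∤⇒coprime : ∀ {p q k} → Prime p → Prime q → ¬ p ∣ k → ¬ q ∣ k → Coprime k (p * q)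
∤∤⇒coprime p-prime q-prime p∤k q∤k = coprime-*ʳ (prime∤⇒coprime p-prime p∤k) (prime∤⇒coprime q-prime q∤k)

coprime-+-* : ∀ k {m n} → Coprime m n → Coprime (k * n + m) n
coprime-+-* zero            m⊥n = m⊥n
coprime-+-* (suc k) {m} {n} m⊥n =
  subst (λ x → Coprime x n) (sym (+-assoc n (k * n) m)) (coprime-+ (coprime-+-* k m⊥n))

prime⇒p∸1≢0 : ∀ {p} → Prime p → NonZero (p ∸ 1)
prime⇒p∸1≢0 {zero}        p-prime = ⊥-elim (¬prime[0] p-prime)
prime⇒p∸1≢0 {suc zero}    p-prime = ⊥-elim (¬prime[1] p-prime)
prime⇒p∸1≢0 {suc (suc _)} _       = _

lcm≢0 : ∀ m n .{{_ : NonZero m}} .{{_ : NonZero n}} → NonZero (lcm m n)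
lcm≢0 m n = m*n≢0⇒n≢0 (gcd m n) {{subst NonZero (sym (gcd*lcm m n)) (m*n≢0 m n)}}

-- lcm and gcd

coprime[abg+a+b,ab] : ∀ {a b} g → Coprime a b → Coprime (a * b * g + a + b) (a * b)
coprime[abg+a+b,ab] {a} {b} g a⊥b = coprime-*ʳ
  (subst (λ x → Coprime x a) (identity₁ a b g) (coprime-+-* (b * g + 1) (Coprime.sym a⊥b)))
  (subst (λ x → Coprime x b) (identity₂ a b g) (coprime-+-* (a * g + 1) a⊥b))
  where identity₁ : ∀ a b g → (b * g + 1) * a + b ≡ a * b * g + a + b
        identity₁ = ℕ-Solver.solve-∀
        identity₂ : ∀ a b g → (a * g + 1) * b + a ≡ a * b * g + a + b
        identity₂ = ℕ-Solver.solve-∀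

lcm[m,n]*gcd[mn+m+n,lcm[m,n]]≡m*n : ∀ m n .{{_ : NonZero m}} →
  lcm m n * gcd (m * n + m + n) (lcm m n) ≡ m * n
lcm[m,n]*gcd[mn+m+n,lcm[m,n]]≡m*n m n = begin
  ℓ * gcd (m * n + m + n) ℓ           ≡⟨ cong₂ (λ x y → ℓ * gcd x y) m*n+m+n≡g*Y ℓ≡g*m′n′ ⟩
  ℓ * gcd (g * Y) (g * (m′ * n′))     ≡⟨ cong (_*_ ℓ) (c*gcd[m,n]≡gcd[cm,cn] g Y (m′ * n′)) ⟨
  ℓ * (g * gcd Y (m′ * n′))           ≡⟨ cong (λ x → ℓ * (g * x)) (coprime⇒gcd≡1 Y⊥m′n′) ⟩
  ℓ * (g * 1)                         ≡⟨ cong (_*_ ℓ) (*-identityʳ g) ⟩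
  ℓ * g                               ≡⟨ *-comm ℓ g ⟩
  g * ℓ                               ≡⟨ gcd*lcm m n ⟩
  m * n                               ∎
  where
  open ≡-Reasoning
  g : ℕ
  g = gcd m n
  instance
    g≢0 : NonZero g
    g≢0 = ≢-nonZero (gcd[m,n]≢0 m n (inj₁ (≢-nonZero⁻¹ m)))
  m′ : ℕ
  m′ = m / g
  n′ : ℕ
  n′ = n / g
  ℓ : ℕ
  ℓ = lcm m n
  m≡m′g : m ≡ m′ * g
  m≡m′g = sym (m/n*n≡m (gcd[m,n]∣m m n))
  n≡n′g : n ≡ n′ * g
  n≡n′g = sym (m/n*n≡m (gcd[m,n]∣n m n))
  Y : ℕ
  Y = m′ * n′ * g + m′ + n′
  ℓ≡g*m′n′ : ℓ ≡ g * (m′ * n′)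
  ℓ≡g*m′n′ = *-cancelˡ-≡ ℓ (g * (m′ * n′)) g (begin
    g * ℓ               ≡⟨ gcd*lcm m n ⟩
    m * n               ≡⟨ cong₂ _*_ m≡m′g n≡n′g ⟩
    m′ * g * (n′ * g)   ≡⟨ identity m′ n′ g ⟩
    g * (g * (m′ * n′)) ∎)
    where identity : ∀ a b g → a * g * (b * g) ≡ g * (g * (a * b))
          identity = ℕ-Solver.solve-∀
  m*n+m+n≡g*Y : m * n + m + n ≡ g * Y
  m*n+m+n≡g*Y = trans (cong₂ (λ x y → x * y + x + y) m≡m′g n≡n′g) (identity m′ n′ g)
    where identity : ∀ a b g → a * g * (b * g) + a * g + b * g ≡ g * (a * b * g + a + b)
          identity = ℕ-Solver.solve-∀
  Y⊥m′n′ : Coprime Y (m′ * n′)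
  Y⊥m′n′ = coprime[abg+a+b,ab] g (coprime-/gcd m n)

m*n∸1≡[m∸1]*[n∸1]+[m∸1]+[n∸1] : ∀ m n .{{_ : NonZero m}} .{{_ : NonZero n}} →
  m * n ∸ 1 ≡ (m ∸ 1) * (n ∸ 1) + (m ∸ 1) + (n ∸ 1)
m*n∸1≡[m∸1]*[n∸1]+[m∸1]+[n∸1] (suc a) (suc b) = expand a b
  where expand : ∀ a b → b + a * suc b ≡ a * b + a + b
        expand = ℕ-Solver.solve-∀

-- Congruences modulo n

infix 4 _≡_mod_

record _≡_mod_ (x y : ℤ) (n : ℕ) : Set where
  constructor ≡-mod
  field ∣-difference : + n ∣ℤ x ℤ.- y

module _ {n : ℕ} where

  ≡⇒≡-mod : ∀ {x y} → x ≡ y → x ≡ y mod n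
  ≡⇒≡-mod {x} refl = ≡-mod (dividesℤ 0ℤ (trans (ℤ.+-inverseʳ x) (sym (ℤ.*-zeroˡ (+ n)))))

  ≡-mod-refl : ∀ {x} → x ≡ x mod n
  ≡-mod-refl = ≡⇒≡-mod refl

  ≡-mod-sym : ∀ {x y} → x ≡ y mod n → y ≡ x mod n
  ≡-mod-sym {x} {y} (≡-mod n∣x-y) = ≡-mod (subst (+ n ∣ℤ_) (negate x y) (∣m⇒∣-m n∣x-y))
    where negate : ∀ x y → ℤ.- (x ℤ.- y) ≡ y ℤ.- x
          negate = ℤ-Solver.solve-∀

  ≡-mod-trans : ∀ {x y z} → x ≡ y mod n → y ≡ z mod n → x ≡ z mod n
  ≡-mod-trans {x} {y} {z} (≡-mod n∣x-y) (≡-mod n∣y-z) =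
    ≡-mod (subst (+ n ∣ℤ_) (telescope x y z) (∣m∣n⇒∣m+n n∣x-y n∣y-z))
    where telescope : ∀ x y z → (x ℤ.- y) ℤ.+ (y ℤ.- z) ≡ x ℤ.- z
          telescope = ℤ-Solver.solve-∀

  ≡-mod-setoid : Setoid 0ℓ 0ℓ
  ≡-mod-setoid = record
    { Carrier = ℤ
    ; _≈_ = _≡_mod n
    ; isEquivalence = record { refl = ≡-mod-refl ; sym = ≡-mod-sym ; trans = ≡-mod-trans }
    }

  +-cong-mod : ∀ {x y u v} → x ≡ y mod n → u ≡ v mod n → x ℤ.+ u ≡ y ℤ.+ v mod n
  +-cong-mod {x} {y} {u} {v} (≡-mod n∣x-y) (≡-mod n∣u-v) =
    ≡-mod (subst (+ n ∣ℤ_) (regroup x y u v) (∣m∣n⇒∣m+n n∣x-y n∣u-v))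
    where regroup : ∀ x y u v → (x ℤ.- y) ℤ.+ (u ℤ.- v) ≡ (x ℤ.+ u) ℤ.- (y ℤ.+ v)
          regroup = ℤ-Solver.solve-∀

  +-congˡ-mod : ∀ x {y z} → y ≡ z mod n → x ℤ.+ y ≡ x ℤ.+ z mod n
  +-congˡ-mod x = +-cong-mod (≡-mod-refl {x})

  +-congʳ-mod : ∀ x {y z} → y ≡ z mod n → y ℤ.+ x ≡ z ℤ.+ x mod n
  +-congʳ-mod x y≡z = +-cong-mod y≡z (≡-mod-refl {x})

  *-cong-mod : ∀ {x y u v} → x ≡ y mod n → u ≡ v mod n → x ℤ.* u ≡ y ℤ.* v mod n
  *-cong-mod {x} {y} {u} {v} (≡-mod n∣x-y) (≡-mod n∣u-v) =
    ≡-mod (subst (+ n ∣ℤ_) (regroup x y u v) (∣m∣n⇒∣m+n (∣m⇒∣m*n u n∣x-y) (∣n⇒∣m*n y n∣u-v)))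
    where regroup : ∀ x y u v → (x ℤ.- y) ℤ.* u ℤ.+ y ℤ.* (u ℤ.- v) ≡ x ℤ.* u ℤ.- y ℤ.* v
          regroup = ℤ-Solver.solve-∀

  *-congˡ-mod : ∀ x {y z} → y ≡ z mod n → x ℤ.* y ≡ x ℤ.* z mod n
  *-congˡ-mod x = *-cong-mod (≡-mod-refl {x})

  ^-cong-mod : ∀ {x y} k → x ≡ y mod n → x ℤ.^ k ≡ y ℤ.^ k mod n
  ^-cong-mod zero    x≡y = ≡-mod-refl
  ^-cong-mod (suc k) x≡y = *-cong-mod x≡y (^-cong-mod k x≡y)

  +-multiple-mod : ∀ x k → x ℤ.+ k ℤ.* + n ≡ x mod n
  +-multiple-mod x k = ≡-mod (dividesℤ k (cancel x k (+ n)))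
    where cancel : ∀ x k n → x ℤ.+ k ℤ.* n ℤ.- x ≡ k ℤ.* n
          cancel = ℤ-Solver.solve-∀

  ≡0-mod⇒∣ : ∀ {x} → x ≡ 0ℤ mod n → + n ∣ℤ x
  ≡0-mod⇒∣ {x} (≡-mod n∣x-0) = subst (+ n ∣ℤ_) (ℤ.+-identityʳ x) n∣x-0

  ∣⇒≡0-mod : ∀ {x} → + n ∣ℤ x → x ≡ 0ℤ mod n
  ∣⇒≡0-mod {x} n∣x = ≡-mod (subst (+ n ∣ℤ_) (sym (ℤ.+-identityʳ x)) n∣x)

module ≡-mod-Reasoning (n : ℕ) = SetoidReasoning (≡-mod-setoid {n})

≡-mod-∣ : ∀ {d n x y} → d ∣ n → x ≡ y mod n → x ≡ y mod d
≡-mod-∣ {d} (divides k refl) (≡-mod n∣x-y) =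
  ≡-mod (∣ᵤ⇒∣ (ℕ.∣-trans (ℕ.n∣m*n k) (∣⇒∣ᵤ n∣x-y)))

≡-mod-* : ∀ {m n x y} → Coprime m n → x ≡ y mod m → x ≡ y mod n → x ≡ y mod (m * n)
≡-mod-* m⊥n (≡-mod m∣x-y) (≡-mod n∣x-y) = ≡-mod (∣ᵤ⇒∣ (coprime-∣⇒*∣ m⊥n (∣⇒∣ᵤ m∣x-y) (∣⇒∣ᵤ n∣x-y)))

pos-^ : ∀ a m → + (a ^ m) ≡ (+ a) ℤ.^ m
pos-^ a zero    = refl
pos-^ a (suc m) = trans (ℤ.pos-* a (a ^ m)) (cong (+ a ℤ.*_) (pos-^ a m))

module _ {n : ℕ} .{{_ : NonZero n}} where

  ≡-mod-% : ∀ x → + x ≡ + (x % n) mod n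
  ≡-mod-% x = subst (λ z → z ≡ + (x % n) mod n) (sym (quotient-remainder x))
                 (+-multiple-mod (+ (x % n)) (+ (x / n)))
    where
    quotient-remainder : ∀ x → + x ≡ + (x % n) ℤ.+ + (x / n) ℤ.* + n
    quotient-remainder x = begin
      + x                              ≡⟨ cong +_ (m≡m%n+[m/n]*n x n) ⟩
      + (x % n + x / n * n)            ≡⟨ ℤ.pos-+ (x % n) (x / n * n) ⟩
      + (x % n) ℤ.+ + (x / n * n)      ≡⟨ cong (λ z → + (x % n) ℤ.+ z) (ℤ.pos-* (x / n) n) ⟩
      + (x % n) ℤ.+ + (x / n) ℤ.* + n  ∎
      where open ≡-Reasoning

  %≡%⇒≡-mod : ∀ {x y} → x % n ≡ y % n → + x ≡ + y mod n
  %≡%⇒≡-mod {x} {y} x%n≡y%n =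
    ≡-mod-trans (≡-mod-% x) (≡-mod-trans (≡⇒≡-mod (cong +_ x%n≡y%n)) (≡-mod-sym (≡-mod-% y)))

  private
    ≡-mod⇒%≡%-≤ : ∀ {x y} → y ≤ x → + x ≡ + y mod n → x % n ≡ y % n
    ≡-mod⇒%≡%-≤ {x} {y} y≤x (≡-mod n∣x-y) = begin
      x % n              ≡⟨ cong (_% n) (m+[n∸m]≡n y≤x) ⟨
      (y + (x ∸ y)) % n  ≡⟨ %-remove-+ʳ y n∣x∸y ⟩
      y % n              ∎
      where
      open ≡-Reasoning
      n∣x∸y : n ∣ x ∸ y
      n∣x∸y = subst (n ∣_) (cong ℤ.∣_∣ (trans (ℤ.m-n≡m⊖n x y) (ℤ.⊖-≥ y≤x))) (∣⇒∣ᵤ n∣x-y)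

  ≡-mod⇒%≡% : ∀ {x y} → + x ≡ + y mod n → x % n ≡ y % n
  ≡-mod⇒%≡% {x} {y} x≡y with ≤-total y x
  ... | inj₁ y≤x = ≡-mod⇒%≡%-≤ y≤x x≡y
  ... | inj₂ x≤y = sym (≡-mod⇒%≡%-≤ x≤y (≡-mod-sym x≡y))

euclidsLemmaℤ : ∀ {p} → Prime p → ∀ x y → + p ∣ℤ x ℤ.* y → + p ∣ℤ x ⊎ + p ∣ℤ y
euclidsLemmaℤ {p} p-prime x y p∣x*y
  with euclidsLemma ℤ.∣ x ∣ ℤ.∣ y ∣ p-prime (subst (p ∣_) (ℤ.abs-* x y) (∣⇒∣ᵤ p∣x*y))
... | inj₁ p∣x = inj₁ (∣ᵤ⇒∣ p∣x)
... | inj₂ p∣y = inj₂ (∣ᵤ⇒∣ p∣y)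

prime∤1 : ∀ {p} → Prime p → ¬ 1ℤ ≡ 0ℤ mod p
prime∤1 p-prime 1≡0 = <⇒≢ (prime>1 p-prime) (sym (ℕ.∣1⇒≡1 (∣⇒∣ᵤ (≡0-mod⇒∣ 1≡0))))

-- Fermat's little theorem

prime∤m! : ∀ {p} → Prime p → ∀ m → m < p → ¬ p ∣ m !
prime∤m! p-prime zero    _   p∣1 = <⇒≢ (prime>1 p-prime) (sym (ℕ.∣1⇒≡1 p∣1))
prime∤m! p-prime (suc m) m<p p∣m! with euclidsLemma (suc m) (m !) p-prime p∣m!
... | inj₁ p∣1+m = <⇒≱ m<p (ℕ.∣⇒≤ p∣1+m)
... | inj₂ p∣m!  = prime∤m! p-prime m (<-trans (n<1+n m) m<p) p∣m!

prime∣pCk : ∀ {p k} → Prime p → 0 < k → k < p → p ∣ p C k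
prime∣pCk {p@(suc p-1)} {k} p-prime 0<k k<p
  with euclidsLemma (p C k) (k ! * (p ∸ k) !) p-prime
         (subst (p ∣_) (sym C*denominator≡p!) (ℕ.m∣m*n (p-1 !)))
  where
  C*denominator≡p! : (p C k) * (k ! * (p ∸ k) !) ≡ p !
  C*denominator≡p! = trans (cong (_* (k ! * (p ∸ k) !)) (nCk≡n!/k![n-k]! (<⇒≤ k<p)))
                           (m/n*n≡m {{k !* (p ∸ k) !≢0}} (k![n∸k]!∣n! (<⇒≤ k<p)))
... | inj₁ p∣C = p∣C
... | inj₂ p∣denominator with euclidsLemma (k !) ((p ∸ k) !) p-prime p∣denominator
...   | inj₁ p∣k!   = ⊥-elim (prime∤m! p-prime k k<p p∣k!)
...   | inj₂ p∣p-k! = ⊥-elim (prime∤m! p-prime (p ∸ k) (∸-monoʳ-< 0<k (<⇒≤ k<p)) p∣p-k!)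

-- The library's binomial theorem is phrased with the generic semiring power _^ₛ_ and
-- multiple _×ₛ_, which agree with ℤ's _^_ and _*_ only up to propositional equality.
open CommutativeSemiring ℤ.+-*-commutativeSemiring using (semiring; +-monoid)
open MonoidSum +-monoid using (sum; sum-init-last)
open SemiringExp semiring using () renaming (_^_ to _^ₛ_)
open RawMonoid (Monoid.rawMonoid +-monoid) using () renaming (_×_ to _×ₛ_)
open Binomial ℤ.+-*-commutativeSemiring
  using (binomialTerm; binomial) renaming (theorem to binomial-theorem)

^ₛ≡^ : ∀ x n → x ^ₛ n ≡ x ℤ.^ n
^ₛ≡^ x zero    = refl
^ₛ≡^ x (suc n) = cong (x ℤ.*_) (^ₛ≡^ x n)

×ₛ≡* : ∀ n x → n ×ₛ x ≡ + n ℤ.* x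
×ₛ≡* zero    x = sym (ℤ.*-zeroˡ x)
×ₛ≡* (suc n) x = trans (cong (ℤ._+_ x) (×ₛ≡* n x)) (sym (ℤ.suc-* (+ n) x))

module _ {m : ℕ} where

  sum≡0-mod : ∀ {n} (f : Vector ℤ n) → (∀ i → f i ≡ 0ℤ mod m) → sum f ≡ 0ℤ mod m
  sum≡0-mod {zero}  f f≡0 = ≡-mod-refl
  sum≡0-mod {suc n} f f≡0 = +-cong-mod (f≡0 zero) (sum≡0-mod (tail f) (f≡0 ∘ suc))

  sum≡first+last-mod : ∀ {n} (f : Vector ℤ (suc (suc n))) → (∀ i → f (suc (inject₁ i)) ≡ 0ℤ mod m) →
    sum f ≡ f zero ℤ.+ f (fromℕ (suc n)) mod m
  sum≡first+last-mod f inner≡0 = begin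
    f zero ℤ.+ sum (tail f)
      ≡⟨ cong (ℤ._+_ (f zero)) (sum-init-last (tail f)) ⟩
    f zero ℤ.+ (sum (init (tail f)) ℤ.+ last (tail f))
      ≈⟨ +-congˡ-mod (f zero) (+-congʳ-mod (last (tail f)) (sum≡0-mod (init (tail f)) inner≡0)) ⟩
    f zero ℤ.+ (0ℤ ℤ.+ last (tail f))
      ≡⟨ cong (ℤ._+_ (f zero)) (ℤ.+-identityˡ (last (tail f))) ⟩
    f zero ℤ.+ last (tail f) ∎
    where open ≡-mod-Reasoning m

binomialTerm-first : ∀ x y n → binomialTerm x y n zero ≡ y ℤ.^ n
binomialTerm-first x y n = begin
  (n C 0) ×ₛ (1ℤ ℤ.* y ^ₛ n)  ≡⟨ ×ₛ≡* (n C 0) (1ℤ ℤ.* y ^ₛ n) ⟩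
  1ℤ ℤ.* (1ℤ ℤ.* y ^ₛ n)     ≡⟨ ℤ.*-identityˡ (1ℤ ℤ.* y ^ₛ n) ⟩
  1ℤ ℤ.* y ^ₛ n              ≡⟨ ℤ.*-identityˡ (y ^ₛ n) ⟩
  y ^ₛ n                     ≡⟨ ^ₛ≡^ y n ⟩
  y ℤ.^ n                    ∎
  where open ≡-Reasoning

binomialTerm-last : ∀ x y n → binomialTerm x y n (fromℕ n) ≡ x ℤ.^ n
binomialTerm-last x y n = begin
  (n C k) ×ₛ (x ^ₛ k ℤ.* y ^ₛ (n ∸ k))     ≡⟨ ×ₛ≡* (n C k) (x ^ₛ k ℤ.* y ^ₛ (n ∸ k)) ⟩
  + (n C k) ℤ.* (x ^ₛ k ℤ.* y ^ₛ (n ∸ k)) ≡⟨ cong (λ k → + (n C k) ℤ.* (x ^ₛ k ℤ.* y ^ₛ (n ∸ k))) (toℕ-fromℕ n) ⟩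
  + (n C n) ℤ.* (x ^ₛ n ℤ.* y ^ₛ (n ∸ n)) ≡⟨ cong₂ (λ c k → + c ℤ.* (x ^ₛ n ℤ.* y ^ₛ k)) (nCn≡1 n) (n∸n≡0 n) ⟩
  1ℤ ℤ.* (x ^ₛ n ℤ.* 1ℤ)                  ≡⟨ ℤ.*-identityˡ (x ^ₛ n ℤ.* 1ℤ) ⟩
  x ^ₛ n ℤ.* 1ℤ                           ≡⟨ ℤ.*-identityʳ (x ^ₛ n) ⟩
  x ^ₛ n                                  ≡⟨ ^ₛ≡^ x n ⟩
  x ℤ.^ n                                 ∎
  where
  open ≡-Reasoning
  k : ℕ
  k = toℕ (fromℕ n)

[x+1]^p≡x^p+1 : ∀ {p} → Prime p → ∀ x → (x ℤ.+ 1ℤ) ℤ.^ p ≡ x ℤ.^ p ℤ.+ 1ℤ mod p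
[x+1]^p≡x^p+1 {p@(suc _)} p-prime x = begin
  (x ℤ.+ 1ℤ) ℤ.^ p                                            ≡⟨ ^ₛ≡^ (x ℤ.+ 1ℤ) p ⟨
  (x ℤ.+ 1ℤ) ^ₛ p                                             ≡⟨ binomial-theorem p x 1ℤ ⟩
  sum (binomialTerm x 1ℤ p)                                   ≈⟨ sum≡first+last-mod (binomialTerm x 1ℤ p) inner-term≡0 ⟩
  binomialTerm x 1ℤ p zero ℤ.+ binomialTerm x 1ℤ p (fromℕ p)
    ≡⟨ cong₂ ℤ._+_ (binomialTerm-first x 1ℤ p) (binomialTerm-last x 1ℤ p) ⟩
  1ℤ ℤ.^ p ℤ.+ x ℤ.^ p                                        ≡⟨ cong₂ ℤ._+_ (ℤ.^-zeroˡ p) refl ⟩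
  1ℤ ℤ.+ x ℤ.^ p                                              ≡⟨ ℤ.+-comm 1ℤ (x ℤ.^ p) ⟩
  x ℤ.^ p ℤ.+ 1ℤ                                              ∎
  where
  open ≡-mod-Reasoning p
  inner-term≡0 : ∀ i → binomialTerm x 1ℤ p (suc (inject₁ i)) ≡ 0ℤ mod p
  inner-term≡0 i = ∣⇒≡0-mod (subst (+ p ∣ℤ_) (sym (×ₛ≡* (p C toℕ j) (binomial x 1ℤ p j)))
    (∣m⇒∣m*n {m = + (p C toℕ j)} (binomial x 1ℤ p j) (∣ᵤ⇒∣ (prime∣pCk p-prime z<s (s≤s (inject₁ℕ< i))))))
    where j = suc (inject₁ i)

n^p≡n-mod : ∀ {p} → Prime p → ∀ n → (+ n) ℤ.^ p ≡ + n mod p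
n^p≡n-mod {zero}  p-prime _       = ⊥-elim (¬prime[0] p-prime)
n^p≡n-mod {suc m} p-prime zero    = ≡⇒≡-mod (ℤ.*-zeroˡ (0ℤ ℤ.^ m))
n^p≡n-mod {p}     p-prime (suc n) = begin
  (+ suc n) ℤ.^ p         ≡⟨ cong (ℤ._^ p) +[1+n]≡+n+1 ⟩
  (+ n ℤ.+ 1ℤ) ℤ.^ p      ≈⟨ [x+1]^p≡x^p+1 p-prime (+ n) ⟩
  (+ n) ℤ.^ p ℤ.+ 1ℤ      ≈⟨ +-congʳ-mod 1ℤ (n^p≡n-mod p-prime n) ⟩
  + n ℤ.+ 1ℤ              ≡⟨ +[1+n]≡+n+1 ⟨
  + suc n                 ∎
  where
  open ≡-mod-Reasoning p
  +[1+n]≡+n+1 : + suc n ≡ + n ℤ.+ 1ℤ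
  +[1+n]≡+n+1 = trans (cong +_ (+-comm 1 n)) (ℤ.pos-+ n 1)

fermat : ∀ {p n} → Prime p → ¬ p ∣ n → (+ n) ℤ.^ (p ∸ 1) ≡ 1ℤ mod p
fermat {zero}      p-prime _   = ⊥-elim (¬prime[0] p-prime)
fermat {p@(suc m)} {n} p-prime p∤n =
  [ (λ p∣n → ⊥-elim (p∤n (∣⇒∣ᵤ p∣n))) , ≡-mod ]′
    (euclidsLemmaℤ p-prime (+ n) ((+ n) ℤ.^ m ℤ.- 1ℤ) (≡0-mod⇒∣ n[n^m-1]≡0))
  where
  open ≡-mod-Reasoning p
  n[n^m-1]≡0 : + n ℤ.* ((+ n) ℤ.^ m ℤ.- 1ℤ) ≡ 0ℤ mod p
  n[n^m-1]≡0 = begin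
    + n ℤ.* ((+ n) ℤ.^ m ℤ.- 1ℤ)  ≡⟨ expand (+ n) ((+ n) ℤ.^ m) ⟩
    (+ n) ℤ.^ p ℤ.- + n           ≈⟨ +-congʳ-mod (ℤ.- + n) (n^p≡n-mod p-prime n) ⟩
    + n ℤ.- + n                   ≡⟨ ℤ.+-inverseʳ (+ n) ⟩
    0ℤ                            ∎
    where expand : ∀ x y → x ℤ.* (y ℤ.- 1ℤ) ≡ x ℤ.* y ℤ.- x
          expand = ℤ-Solver.solve-∀

^-period-mod : ∀ {n x m} → x ℤ.^ m ≡ 1ℤ mod n → ∀ r k → x ℤ.^ (r + k * m) ≡ x ℤ.^ r mod n
^-period-mod {n} {x} {m} x^m≡1 r k = begin
  x ℤ.^ (r + k * m)              ≡⟨ ℤ.^-distribˡ-+-* x r (k * m) ⟩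
  x ℤ.^ r ℤ.* x ℤ.^ (k * m)      ≡⟨ cong (λ e → x ℤ.^ r ℤ.* x ℤ.^ e) (*-comm k m) ⟩
  x ℤ.^ r ℤ.* x ℤ.^ (m * k)      ≡⟨ cong (ℤ._*_ (x ℤ.^ r)) (ℤ.^-*-assoc x m k) ⟨
  x ℤ.^ r ℤ.* (x ℤ.^ m) ℤ.^ k    ≈⟨ *-congˡ-mod (x ℤ.^ r) (^-cong-mod k x^m≡1) ⟩
  x ℤ.^ r ℤ.* 1ℤ ℤ.^ k           ≡⟨ cong (ℤ._*_ (x ℤ.^ r)) (ℤ.^-zeroˡ k) ⟩
  x ℤ.^ r ℤ.* 1ℤ                 ≡⟨ ℤ.*-identityʳ (x ℤ.^ r) ⟩
  x ℤ.^ r                        ∎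
  where open ≡-mod-Reasoning n

^-%-period-mod : ∀ {n x} m .{{_ : NonZero m}} → x ℤ.^ m ≡ 1ℤ mod n → ∀ L → x ℤ.^ L ≡ x ℤ.^ (L % m) mod n
^-%-period-mod {n} {x} m x^m≡1 L = subst (λ e → x ℤ.^ e ≡ x ℤ.^ (L % m) mod n) (sym (m≡m%n+[m/n]*n L m))
  (^-period-mod x^m≡1 (L % m) (L / m))

^-multiple-of-p∸1≡1 : ∀ {p c e} → Prime p → ¬ p ∣ c → p ∸ 1 ∣ e → (+ c) ℤ.^ e ≡ 1ℤ mod p
^-multiple-of-p∸1≡1 p-prime p∤c (divides k refl) = ^-period-mod (fermat p-prime p∤c) 0 k

-- Roots of polynomials modulo a prime

-- [c₀, …, cₖ] stands for the monic polynomial c₀ + c₁x + ⋯ + cₖxᵏ + xᵏ⁺¹: its degree is its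
-- length and its leading coefficient is 1 modulo every n.
monic : List ℤ → ℤ → ℤ
monic []       x = 1ℤ
monic (c ∷ cs) x = c ℤ.+ x ℤ.* monic cs x

-- The quotient of monic (c ∷ cs) by x − r; it does not depend on c.
deflate : ℤ → List ℤ → List ℤ
deflate r []       = []
deflate r (c ∷ cs) = monic (c ∷ cs) r ∷ deflate r cs

monic-zeros : ∀ n x → monic (replicate n 0ℤ) x ≡ x ℤ.^ n
monic-zeros zero    x = refl
monic-zeros (suc n) x =
  trans (ℤ.+-identityˡ (x ℤ.* monic (replicate n 0ℤ) x)) (cong (ℤ._*_ x) (monic-zeros n x))

length-deflate : ∀ r cs → length (deflate r cs) ≡ length cs
length-deflate r []       = refl
length-deflate r (c ∷ cs) = cong suc (length-deflate r cs)

remainder-theorem : ∀ r x c cs →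
  monic (c ∷ cs) x ≡ (x ℤ.- r) ℤ.* monic (deflate r cs) x ℤ.+ monic (c ∷ cs) r
remainder-theorem r x c [] = identity c x r
  where identity : ∀ c x r → c ℤ.+ x ℤ.* 1ℤ ≡ (x ℤ.- r) ℤ.* 1ℤ ℤ.+ (c ℤ.+ r ℤ.* 1ℤ)
        identity = ℤ-Solver.solve-∀
remainder-theorem r x c (d ∷ ds) = begin
  c ℤ.+ x ℤ.* monic (d ∷ ds) x                   ≡⟨ cong (λ z → c ℤ.+ x ℤ.* z) (remainder-theorem r x d ds) ⟩
  c ℤ.+ x ℤ.* ((x ℤ.- r) ℤ.* Q ℤ.+ M)            ≡⟨ identity c x r Q M ⟩
  (x ℤ.- r) ℤ.* (M ℤ.+ x ℤ.* Q) ℤ.+ (c ℤ.+ r ℤ.* M) ∎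
  where
  open ≡-Reasoning
  Q : ℤ
  Q = monic (deflate r ds) x
  M : ℤ
  M = monic (d ∷ ds) r
  identity : ∀ c x r Q M →
    c ℤ.+ x ℤ.* ((x ℤ.- r) ℤ.* Q ℤ.+ M) ≡ (x ℤ.- r) ℤ.* (M ℤ.+ x ℤ.* Q) ℤ.+ (c ℤ.+ r ℤ.* M)
  identity = ℤ-Solver.solve-∀

module _ {p : ℕ} (p-prime : Prime p) where

  private
    remainder-vanishes : ∀ {r s c cs} →
      monic (c ∷ cs) r ≡ 0ℤ mod p → monic (c ∷ cs) s ≡ 0ℤ mod p →
      (s ℤ.- r) ℤ.* monic (deflate r cs) s ≡ 0ℤ mod p
    remainder-vanishes {r} {s} {c} {cs} r-root s-root = begin
      (s ℤ.- r) ℤ.* Q                   ≡⟨ ℤ.+-identityʳ ((s ℤ.- r) ℤ.* Q) ⟨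
      (s ℤ.- r) ℤ.* Q ℤ.+ 0ℤ            ≈⟨ +-congˡ-mod ((s ℤ.- r) ℤ.* Q) (≡-mod-sym r-root) ⟩
      (s ℤ.- r) ℤ.* Q ℤ.+ monic (c ∷ cs) r ≡⟨ remainder-theorem r s c cs ⟨
      monic (c ∷ cs) s                  ≈⟨ s-root ⟩
      0ℤ                                ∎
      where
      open ≡-mod-Reasoning p
      Q : ℤ
      Q = monic (deflate r cs) s

  root-of-deflate : ∀ {r s c cs} → ¬ s ≡ r mod p →
    monic (c ∷ cs) r ≡ 0ℤ mod p → monic (c ∷ cs) s ≡ 0ℤ mod p → monic (deflate r cs) s ≡ 0ℤ mod p
  root-of-deflate {r} {s} {c} {cs} s≢r r-root s-root =
    [ (λ p∣s-r → ⊥-elim (s≢r (≡-mod p∣s-r))) , ∣⇒≡0-mod ]′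
      (euclidsLemmaℤ p-prime (s ℤ.- r) (monic (deflate r cs) s)
        (≡0-mod⇒∣ (remainder-vanishes {r} {s} {c} {cs} r-root s-root)))

  roots≤degree : ∀ rs cs → AllPairs (λ r s → ¬ r ≡ s mod p) rs →
    All (λ r → monic cs r ≡ 0ℤ mod p) rs → length rs ≤ length cs
  roots≤degree []       cs       _                 _              = z≤n
  roots≤degree (r ∷ rs) []       _                 (r-root ∷ _)   = ⊥-elim (prime∤1 p-prime r-root)
  roots≤degree (r ∷ rs) (c ∷ cs) (r≢rs ∷ distinct) (r-root ∷ roots) =
    s≤s (subst (length rs ≤_) (length-deflate r cs)
      (roots≤degree rs (deflate r cs) distinct (deflated r≢rs roots)))
    where
    deflated : ∀ {ss} → All (λ s → ¬ r ≡ s mod p) ss → All (λ s → monic (c ∷ cs) s ≡ 0ℤ mod p) ss →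
               All (λ s → monic (deflate r cs) s ≡ 0ℤ mod p) ss
    deflated []             []                = []
    deflated {s ∷ _} (r≢s ∷ r≢ss) (s-root ∷ ss-roots) =
      root-of-deflate {r} {s} {c} {cs} (λ s≡r → r≢s (≡-mod-sym s≡r)) r-root s-root
        ∷ deflated r≢ss ss-roots

small-residues-distinct : ∀ {p m} → m < p →
  AllPairs (λ a b → ¬ a ≡ b mod p) (applyUpTo (λ i → + suc i) m)
small-residues-distinct {p@(suc _)} {m} m<p =
  AllPairs.applyUpTo⁺₁ (λ i → + suc i) m λ {i} {j} i<j j<m i≡j → <⇒≢ i<j (suc-injective (begin
    suc i      ≡⟨ m<n⇒m%n≡m (≤-<-trans i<j (<-trans j<m m<p)) ⟨
    suc i % p  ≡⟨ ≡-mod⇒%≡% {x = suc i} {suc j} i≡j ⟩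
    suc j % p  ≡⟨ m<n⇒m%n≡m (≤-<-trans j<m m<p) ⟩
    suc j      ∎))
  where open ≡-Reasoning

p∸1∣exponent : ∀ {p L} → Prime p → (∀ c → ¬ p ∣ c → (+ c) ℤ.^ L ≡ 1ℤ mod p) → p ∸ 1 ∣ L
p∸1∣exponent {zero}     p-prime _ = ⊥-elim (¬prime[0] p-prime)
p∸1∣exponent {suc zero} p-prime _ = ⊥-elim (¬prime[1] p-prime)
p∸1∣exponent {p@(suc m@(suc _))} {L} p-prime c^L≡1 with L % m in L%m≡r
... | zero  = m%n≡0⇒n∣m L m L%m≡r
... | suc r = ⊥-elim (<⇒≱ (subst (_< m) L%m≡r (m%n<n L m)) m≤1+r)
  where
  c^[1+r]≡1 : ∀ {c} → ¬ p ∣ c → (+ c) ℤ.^ suc r ≡ 1ℤ mod p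
  c^[1+r]≡1 {c} p∤c = subst (λ e → (+ c) ℤ.^ e ≡ 1ℤ mod p) L%m≡r
    (≡-mod-trans (≡-mod-sym (^-%-period-mod m (fermat p-prime p∤c) L)) (c^L≡1 c p∤c))

  vanish : All (λ x → monic (ℤ.- 1ℤ ∷ replicate r 0ℤ) x ≡ 0ℤ mod p) (applyUpTo (λ i → + suc i) m)
  vanish = All.applyUpTo⁺₁ (λ i → + suc i) m λ {i} i<m → begin
    ℤ.- 1ℤ ℤ.+ + suc i ℤ.* monic (replicate r 0ℤ) (+ suc i)
      ≡⟨ cong (λ z → ℤ.- 1ℤ ℤ.+ + suc i ℤ.* z) (monic-zeros r (+ suc i)) ⟩
    ℤ.- 1ℤ ℤ.+ (+ suc i) ℤ.^ suc r
      ≈⟨ +-congˡ-mod (ℤ.- 1ℤ) (c^[1+r]≡1 (>⇒∤ (s≤s i<m))) ⟩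
    0ℤ ∎
    where open ≡-mod-Reasoning p

  m≤1+r : m ≤ suc r
  m≤1+r = subst₂ _≤_ (length-applyUpTo (λ i → + suc i) m) (cong suc (length-replicate r))
    (roots≤degree p-prime _ (ℤ.- 1ℤ ∷ replicate r 0ℤ) (small-residues-distinct (n<1+n m)) vanish)

-- Counting

indicator : ∀ {a} {A : Set a} → Dec A → ℕ
indicator a? = if does a? then 1 else 0

module _ {a} {A : Set a} (a? : Dec A) where

  indicator-yes : A → indicator a? ≡ 1
  indicator-yes x rewrite dec-true a? x = refl

  indicator-no : ¬ A → indicator a? ≡ 0
  indicator-no ¬x rewrite dec-false a? ¬x = refl

count : ∀ {ℓ} {P : Pred ℕ ℓ} → Decidable P → ℕ → ℕ
count P? n = length (filter P? (upTo n))

module _ {ℓ} {P : Pred ℕ ℓ} (P? : Decidable P) where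

  count-suc : ∀ n → count P? (suc n) ≡ count P? n + indicator (P? n)
  count-suc n = begin
    length (filter P? (upTo (suc n)))               ≡⟨ cong (length ∘ filter P?) (upTo-∷ʳ n) ⟨
    length (filter P? (upTo n ∷ʳ n))                ≡⟨ cong length (filter-++ P? (upTo n) [ n ]) ⟩
    length (filter P? (upTo n) ++ filter P? [ n ])  ≡⟨ length-++ (filter P? (upTo n)) ⟩
    count P? n + length (filter P? [ n ])           ≡⟨ cong (_+_ (count P? n)) singleton ⟩
    count P? n + indicator (P? n)                   ∎
    where
    open ≡-Reasoning
    singleton : length (filter P? [ n ]) ≡ indicator (P? n)
    singleton with does (P? n)
    ... | true  = refl
    ... | false = refl

count-inclusion-exclusion : ∀ {ℓ} {P Q R S : Pred ℕ ℓ}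
  (P? : Decidable P) (Q? : Decidable Q) (R? : Decidable R) (S? : Decidable S) →
  (∀ k → indicator (P? k) + indicator (Q? k) + indicator (R? k) ≡ 1 + indicator (S? k)) →
  ∀ n → count P? n + count Q? n + count R? n ≡ n + count S? n
count-inclusion-exclusion P? Q? R? S? pointwise zero    = refl
count-inclusion-exclusion P? Q? R? S? pointwise (suc n) = begin
  count P? (suc n) + count Q? (suc n) + count R? (suc n)
    ≡⟨ cong₂ _+_ (cong₂ _+_ (count-suc P? n) (count-suc Q? n)) (count-suc R? n) ⟩
  (count P? n + iP) + (count Q? n + iQ) + (count R? n + iR)
    ≡⟨ regroup (count P? n) (count Q? n) (count R? n) iP iQ iR ⟩
  (count P? n + count Q? n + count R? n) + (iP + iQ + iR)
    ≡⟨ cong₂ _+_ (count-inclusion-exclusion P? Q? R? S? pointwise n) (pointwise n) ⟩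
  (n + count S? n) + (1 + indicator (S? n))
    ≡⟨ regroup′ n (count S? n) (indicator (S? n)) ⟩
  suc n + (count S? n + indicator (S? n))
    ≡⟨ cong (_+_ (suc n)) (count-suc S? n) ⟨
  suc n + count S? (suc n) ∎
  where
  open ≡-Reasoning
  iP : ℕ
  iP = indicator (P? n)
  iQ : ℕ
  iQ = indicator (Q? n)
  iR : ℕ
  iR = indicator (R? n)
  regroup : ∀ a b c i j k → (a + i) + (b + j) + (c + k) ≡ (a + b + c) + (i + j + k)
  regroup = ℕ-Solver.solve-∀
  regroup′ : ∀ n s i → (n + s) + (1 + i) ≡ suc n + (s + i)
  regroup′ = ℕ-Solver.solve-∀

count-multiples : ∀ d .{{_ : NonZero d}} m → count (d ∣?_) (m * d) ≡ m
count-multiples (suc d-1) zero    = refl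
count-multiples d@(suc d-1) (suc m) =
  trans (next-multiple d-1 ≤-refl) (cong suc (count-multiples d m))
  where
  next-multiple : ∀ r → r < d → count (d ∣?_) (suc r + m * d) ≡ suc (count (d ∣?_) (m * d))
  next-multiple zero    _   = begin
    count (d ∣?_) (suc (m * d))
      ≡⟨ count-suc (d ∣?_) (m * d) ⟩
    count (d ∣?_) (m * d) + indicator (d ∣? m * d)
      ≡⟨ cong (_+_ (count (d ∣?_) (m * d))) (indicator-yes (d ∣? m * d) (ℕ.n∣m*n m)) ⟩
    count (d ∣?_) (m * d) + 1
      ≡⟨ +-comm (count (d ∣?_) (m * d)) 1 ⟩
    suc (count (d ∣?_) (m * d)) ∎
    where open ≡-Reasoning
  next-multiple (suc r) r<d = begin
    count (d ∣?_) (suc (suc r + m * d))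
      ≡⟨ count-suc (d ∣?_) (suc r + m * d) ⟩
    count (d ∣?_) (suc r + m * d) + indicator (d ∣? suc r + m * d)
      ≡⟨ cong (_+_ (count (d ∣?_) (suc r + m * d))) (indicator-no (d ∣? suc r + m * d) d∤) ⟩
    count (d ∣?_) (suc r + m * d) + 0
      ≡⟨ +-identityʳ (count (d ∣?_) (suc r + m * d)) ⟩
    count (d ∣?_) (suc r + m * d)
      ≡⟨ next-multiple r (<-trans (n<1+n r) r<d) ⟩
    suc (count (d ∣?_) (m * d)) ∎
    where
    open ≡-Reasoning
    d∤ : ¬ d ∣ suc r + m * d
    d∤ d∣ = >⇒∤ r<d (∣m+n∣m⇒∣n (subst (d ∣_) (+-comm (suc r) (m * d)) d∣) (ℕ.n∣m*n m))

-- The Carmichael function of p q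

annihilates⇒≡1-mod : ∀ {N L d b c} .{{_ : NonZero N}} → Annihilates N L → d ∣ N →
  Coprime b N → + b ≡ + c mod d → (+ c) ℤ.^ L ≡ 1ℤ mod d
annihilates⇒≡1-mod {N} {L} {d} {b} {c} annihilates d∣N b⊥N b≡c = begin
  (+ c) ℤ.^ L    ≈⟨ ^-cong-mod L b≡c ⟨
  (+ b) ℤ.^ L    ≡⟨ pos-^ b L ⟨
  + (b ^ L)      ≈⟨ ≡-mod-∣ d∣N (%≡%⇒≡-mod (annihilates b b⊥N)) ⟩
  1ℤ             ∎
  where open ≡-mod-Reasoning d

unit-lift : ∀ {p q c} → Prime p → Prime q → p ≢ q → ¬ p ∣ c →
  ∃[ b ] Coprime b (p * q) × + b ≡ + c mod p
unit-lift {p} {q} {c} p-prime q-prime p≢q p∤c with q ∣? c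
... | no  q∤c = c , ∤∤⇒coprime p-prime q-prime p∤c q∤c , ≡-mod-refl
... | yes q∣c = c + p , ∤∤⇒coprime p-prime q-prime p∤c+p q∤c+p , c+p≡c
  where
  p∤c+p : ¬ p ∣ c + p
  p∤c+p p∣c+p = p∤c (∣m+n∣m⇒∣n (subst (p ∣_) (+-comm c p) p∣c+p) ℕ.∣-refl)
  q∤c+p : ¬ q ∣ c + p
  q∤c+p q∣c+p = prime∤prime q-prime p-prime (p≢q ∘ sym) (∣m+n∣m⇒∣n q∣c+p q∣c)
  c+p≡c : + (c + p) ≡ + c mod p
  c+p≡c = subst (λ x → x ≡ + c mod p)
    (trans (cong (ℤ._+_ (+ c)) (ℤ.*-identityˡ (+ p))) (sym (ℤ.pos-+ c p)))
    (+-multiple-mod (+ c) 1ℤ)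

module _ {p q} (p-prime : Prime p) (q-prime : Prime q) (p≢q : p ≢ q) where

  private
    p⊥q : Coprime p q
    p⊥q = prime∤⇒coprime q-prime (prime∤prime q-prime p-prime (p≢q ∘ sym))

    coprime⇒p∤ : ∀ {k} → Coprime k (p * q) → ¬ p ∣ k
    coprime⇒p∤ k⊥pq = coprime⇒∤ k⊥pq (ℕ.m∣m*n q) (prime>1 p-prime)

    coprime⇒q∤ : ∀ {k} → Coprime k (p * q) → ¬ q ∣ k
    coprime⇒q∤ k⊥pq = coprime⇒∤ k⊥pq (ℕ.n∣m*n p) (prime>1 q-prime)

    indicators : ∀ k → indicator (coprime? k (p * q)) + indicator (p ∣? k) + indicator (q ∣? k)
                     ≡ 1 + indicator (p * q ∣? k)
    indicators k with p ∣? k | q ∣? k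
    ... | yes p∣k | yes q∣k
      rewrite indicator-no (coprime? k (p * q)) (λ k⊥pq → coprime⇒p∤ k⊥pq p∣k)
            | indicator-yes (p * q ∣? k) (coprime-∣⇒*∣ p⊥q p∣k q∣k) = refl
    ... | yes p∣k | no q∤k
      rewrite indicator-no (coprime? k (p * q)) (λ k⊥pq → coprime⇒p∤ k⊥pq p∣k)
            | indicator-no (p * q ∣? k) (q∤k ∘ ℕ.∣-trans (ℕ.n∣m*n p)) = refl
    ... | no p∤k | yes q∣k
      rewrite indicator-no (coprime? k (p * q)) (λ k⊥pq → coprime⇒q∤ k⊥pq q∣k)
            | indicator-no (p * q ∣? k) (p∤k ∘ ℕ.∣-trans (ℕ.m∣m*n q)) = refl
    ... | no p∤k | no q∤k
      rewrite indicator-yes (coprime? k (p * q)) (∤∤⇒coprime p-prime q-prime p∤k q∤k)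
            | indicator-no (p * q ∣? k) (p∤k ∘ ℕ.∣-trans (ℕ.m∣m*n q)) = refl

  φ[pq]≡[p∸1]*[q∸1] : φ (p * q) ≡ (p ∸ 1) * (q ∸ 1)
  φ[pq]≡[p∸1]*[q∸1] = +-cancelʳ-≡ (q + p) (φ (p * q)) ((p ∸ 1) * (q ∸ 1)) (begin
    φ (p * q) + (q + p)
      ≡⟨ +-assoc (φ (p * q)) q p ⟨
    φ (p * q) + q + p
      ≡⟨ cong₂ (λ x y → φ (p * q) + x + y) multiples-of-p multiples-of-q ⟨
    φ (p * q) + count (p ∣?_) (p * q) + count (q ∣?_) (p * q)
      ≡⟨ count-inclusion-exclusion _ (p ∣?_) (q ∣?_) (p * q ∣?_) indicators (p * q) ⟩
    p * q + count (p * q ∣?_) (p * q)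
      ≡⟨ cong (_+_ (p * q)) multiples-of-pq ⟩
    p * q + 1
      ≡⟨ expand p q (prime>1 p-prime) (prime>1 q-prime) ⟩
    (p ∸ 1) * (q ∸ 1) + (q + p) ∎)
    where
    open ≡-Reasoning
    instance
      p≢0 : NonZero p
      p≢0 = prime⇒nonZero p-prime
      q≢0 : NonZero q
      q≢0 = prime⇒nonZero q-prime
    multiples-of-p : count (p ∣?_) (p * q) ≡ q
    multiples-of-p = trans (cong (count (p ∣?_)) (*-comm p q)) (count-multiples p q)
    multiples-of-q : count (q ∣?_) (p * q) ≡ p
    multiples-of-q = count-multiples q p
    multiples-of-pq : count (p * q ∣?_) (p * q) ≡ 1
    multiples-of-pq = trans (cong (count (p * q ∣?_)) (sym (*-identityˡ (p * q))))
                            (count-multiples (p * q) {{m*n≢0 p q}} 1)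
    expand : ∀ p q → 1 < p → 1 < q → p * q + 1 ≡ (p ∸ 1) * (q ∸ 1) + (q + p)
    expand (suc a) (suc b) _ _ = identity a b
      where identity : ∀ a b → suc a * suc b + 1 ≡ a * b + (suc b + suc a)
            identity = ℕ-Solver.solve-∀

  module _ .{{_ : NonZero (p * q)}} where

    private
      instance
        p∸1≢0 : NonZero (p ∸ 1)
        p∸1≢0 = prime⇒p∸1≢0 p-prime
        q∸1≢0 : NonZero (q ∸ 1)
        q∸1≢0 = prime⇒p∸1≢0 q-prime

    lcm-annihilates : Annihilates (p * q) (lcm (p ∸ 1) (q ∸ 1))
    lcm-annihilates c c⊥pq = ≡-mod⇒%≡%
      (subst (λ x → x ≡ 1ℤ mod (p * q)) (sym (pos-^ c (lcm (p ∸ 1) (q ∸ 1)))) (≡-mod-* p⊥q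
        (^-multiple-of-p∸1≡1 p-prime (coprime⇒p∤ c⊥pq) (m∣lcm[m,n] (p ∸ 1) (q ∸ 1)))
        (^-multiple-of-p∸1≡1 q-prime (coprime⇒q∤ c⊥pq) (n∣lcm[m,n] (p ∸ 1) (q ∸ 1)))))

    lcm∣annihilator : ∀ {L} → Annihilates (p * q) L → lcm (p ∸ 1) (q ∸ 1) ∣ L
    lcm∣annihilator {L} annihilates =
      lcm-least (p∸1∣exponent p-prime units-mod-p) (p∸1∣exponent q-prime units-mod-q)
      where
      units-mod-p : ∀ c → ¬ p ∣ c → (+ c) ℤ.^ L ≡ 1ℤ mod p
      units-mod-p c p∤c =
        let b , b⊥pq , b≡c = unit-lift p-prime q-prime p≢q p∤c
        in annihilates⇒≡1-mod {L = L} annihilates (ℕ.m∣m*n q) b⊥pq b≡c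
      units-mod-q : ∀ c → ¬ q ∣ c → (+ c) ℤ.^ L ≡ 1ℤ mod q
      units-mod-q c q∤c =
        let b , b⊥qp , b≡c = unit-lift q-prime p-prime (p≢q ∘ sym) q∤c
        in annihilates⇒≡1-mod {L = L} annihilates (ℕ.n∣m*n p) (subst (Coprime b) (*-comm q p) b⊥qp) b≡c

    carmichael[pq]≡lcm : ∀ {L} → IsCarmichael (p * q) L → L ≡ lcm (p ∸ 1) (q ∸ 1)
    carmichael[pq]≡lcm (0<L , annihilates , least) = ≤-antisym
      (least (lcm (p ∸ 1) (q ∸ 1)) (>-nonZero⁻¹ _ {{lcm≢0 (p ∸ 1) (q ∸ 1)}}) lcm-annihilates)
      (ℕ.∣⇒≤ {{>-nonZero 0<L}} (lcm∣annihilator annihilates))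

lemma5p3 : ∀ (p q : ℕ) → Prime p → Prime q → p ≢ q →
    .{{_ : NonZero (p * q)}} →
    ∀ (L : ℕ) → IsCarmichael (p * q) L →
    φ (p * q) ≡ L * gcd (p * q ∸ 1) L
lemma5p3 p q p-prime q-prime p≢q L carmichael = begin
  φ (p * q)                                     ≡⟨ φ[pq]≡[p∸1]*[q∸1] p-prime q-prime p≢q ⟩
  a * b                                         ≡⟨ lcm[m,n]*gcd[mn+m+n,lcm[m,n]]≡m*n a b ⟨
  lcm a b * gcd (a * b + a + b) (lcm a b)       ≡⟨ cong₂ (λ l n → l * gcd n l) L≡lcm pq∸1≡ab+a+b ⟨
  L * gcd (p * q ∸ 1) L                         ∎
  where
  open ≡-Reasoning
  a : ℕ
  a = p ∸ 1
  b : ℕ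
  b = q ∸ 1
  instance
    a≢0 : NonZero a
    a≢0 = prime⇒p∸1≢0 p-prime
  L≡lcm : L ≡ lcm a b
  L≡lcm = carmichael[pq]≡lcm p-prime q-prime p≢q carmichael
  pq∸1≡ab+a+b : p * q ∸ 1 ≡ a * b + a + b
  pq∸1≡ab+a+b = m*n∸1≡[m∸1]*[n∸1]+[m∸1]+[n∸1] p q {{prime⇒nonZero p-prime}} {{prime⇒nonZero q-prime}}
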